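{- Let $\Sigma$ be an ordered alphabet and let $w\in\Sigma^n$ be a self-minimal word. One can construct a sparse deterministic finite automaton with $O(n)$ states recognizing $L(w)$.
   Context: $w$ is self-minimal if it is lexicographically not greater than any of its cyclic rotations. $w_{(i)}$ is the prefix of length $i$ of $w$ and $w[i]$ its $i$-th letter. $\mathrm{Pref}_-(w)=\{w_{(i)}s : 0\le i\le n-1,\ s\in\Sigma,\ s<w[i+1]\}\cup\{w\}$, and $L(w)$ is the set of words over $\Sigma$ having a factor in $\mathrm{Pref}_-(w)$. An automaton with state set $Q$ is sparse if its underlying directed graph has $O(|Q|)$ edges, counting parallel edges as one. -}

module Defs where

open import Data.Nat using (ℕ; zero; suc; _+_; _*_) renaming (_<_ to _<ℕ_)
open import Data.Fin using (Fin; toℕ) renaming (_<_ to _<F_)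
open import Data.Fin.Properties using (any?; _≟_)
open import Data.Bool using (Bool; true)
open import Data.List using (List; []; _∷_; _++_; take; drop; length; filter; allFin; cartesianProduct; foldl)
open import Data.Product using (Σ; ∃; _×_; _,_)
open import Data.Sum using (_⊎_)
open import Relation.Binary.PropositionalEquality using (_≡_)
open import Data.List.Relation.Binary.Lex.Strict using (Lex-≤)

-- The ordered alphabet Σ is Fin k with its natural order.
Word : ℕ → Set
Word k = List (Fin k)

_≤lex_ : ∀ {k} → Word k → Word k → Set
_≤lex_ = Lex-≤ _≡_ _<F_

rotate : ∀ {k} → ℕ → Word k → Word k
rotate i w = drop i w ++ take i w

SelfMinimal : ∀ {k} → Word k → Set
SelfMinimal w = ∀ i → i <ℕ length w → w ≤lex rotate i w

letter : ∀ {k} (w : Word k) (i : ℕ) → i <ℕ length w → Fin k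
letter (a ∷ w) zero    _              = a
letter (a ∷ w) (suc i) (Data.Nat.s≤s p) = letter w i p

-- Pref₋(w) = { w_(i) s : 0 ≤ i ≤ n-1, s < w[i+1] } ∪ { w }
-- (with 0-indexed letters, w[i+1] in the paper is letter w i here)
InPref₋ : ∀ {k} → Word k → Word k → Set
InPref₋ w y =
  (Σ ℕ λ i → Σ (i <ℕ length w) λ p → Σ (Fin _) λ s →
     s <F letter w i p × y ≡ take i w ++ (s ∷ []))
  ⊎ y ≡ w

L : ∀ {k} → Word k → Word k → Set
L w u = ∃ λ x → ∃ λ y → ∃ λ z → u ≡ x ++ y ++ z × InPref₋ w y

record DFA (k : ℕ) : Set where
  field
    states    : ℕ
    initial   : Fin states
    δ         : Fin states → Fin k → Fin states
    accepting : Fin states → Bool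

  run : Fin states → Word k → Fin states
  run q []       = q
  run q (a ∷ u)  = run (δ q a) u

  Accepts : Word k → Set
  Accepts u = accepting (run initial u) ≡ true

  -- number of edges of the underlying directed graph
  -- (ordered pairs (q , q') with some letter a such that δ q a ≡ q';
  --  parallel edges counted once)
  edgeCount : ℕ
  edgeCount = length (filter (λ { (q , q') → any? (λ a → δ q a ≟ q') })
                             (cartesianProduct (allFin states) (allFin states)))

open DFA public

Recognizes : ∀ {k} → DFA k → (Word k → Set) → Set
Recognizes A P = ∀ u → (Accepts A u → P u) × (P u → Accepts A u)

module Submission where

-- Writing w_(i) for the prefix of length i, the automaton is in state i after
-- reading a word whose relevant memory is w_(i); state n is an accepting sink.
-- On a letter a, state i < n moves to n if a < w[i+1], to i + 1 if a = w[i+1],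
-- and back to 0 if a > w[i+1].  So every state has at most three successors.

open import Defs
open import Level using (0ℓ)
open import Data.Nat using (ℕ; zero; suc; _+_; _*_; _≤_; z≤n; s≤s; _<?_) renaming (_<_ to _<ℕ_; _≟_ to _≟ℕ_)
open import Data.Nat.Properties
  using (≤-refl; ≤-reflexive; ≤-trans; ≤-pred; <-≤-trans; ≮⇒≥; ≤∧≢⇒<; n≤1+n; m∸n≤m; m⊓n≤m; m≤n*m;
         +-comm; +-mono-≤; +-monoʳ-≤; +-suc; *-suc; module ≤-Reasoning)
open import Data.Fin using (Fin; toℕ; fromℕ<) renaming (_<_ to _<F_)
open import Data.Fin.Properties using (any?; _≟_; toℕ-injective; toℕ-fromℕ<; toℕ<n; <-cmp; <-asym; <-irrefl; <-trans)
open import Data.List using (List; []; _∷_; _++_; take; drop; length; filter; map; allFin; cartesianProduct)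
open import Data.List.Properties
  using (filter-accept; filter-reject; filter-none; filter-++; length-++; length-tabulate;
         ++-assoc; ++-identityʳ; take++drop≡id; take-all; length-take; length-drop)
open import Data.List.Membership.Propositional using (_∈_)
open import Data.List.Membership.DecPropositional _≟ℕ_ using (_∈?_)
open import Data.List.Relation.Unary.Any using (here; there)
open import Data.List.Relation.Unary.All as All using (All)
open import Data.List.Relation.Unary.AllPairs using (_∷_)
open import Data.List.Relation.Unary.Unique.Propositional using (Unique)
open import Data.List.Relation.Unary.Unique.Propositional.Properties using (allFin⁺)
open import Data.List.Relation.Binary.Sublist.Propositional using (⊆-refl)
open import Data.List.Relation.Binary.Sublist.Propositional.Properties using (filter⁺; length-mono-≤)
open import Data.List.Relation.Binary.Lex.Strict using (this; next)
open import Data.Product using (∃; _×_; _,_)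
open import Data.Sum using (_⊎_; inj₁; inj₂)
open import Data.Empty using (⊥; ⊥-elim)
open import Data.Unit using (⊤; tt)
open import Data.Bool using (true)
open import Function using (_∘_; const)
open import Function.Bundles using (_⇔_; mk⇔; Equivalence)
open import Function.Construct.Composition using (_⇔-∘_)
open import Relation.Binary.PropositionalEquality using (_≡_; _≢_; refl; sym; trans; cong; subst; module ≡-Reasoning)
open import Relation.Binary.Definitions using (tri<; tri≈; tri>)
open import Relation.Nullary using (¬_; Dec; yes; no; does; contradiction)
open import Relation.Unary using (Pred; Decidable)

count : {A : Set} {P : Pred A 0ℓ} → Decidable P → List A → ℕ
count P? xs = length (filter P? xs)

module _ {A : Set} {P : Pred A 0ℓ} (P? : Decidable P) where

  count-≤-∷ : (x : A) (xs : List A) → count P? xs ≤ count P? (x ∷ xs)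
  count-≤-∷ x xs with P? x
  ... | yes _ = n≤1+n _
  ... | no _  = ≤-refl

  count-accept : {x : A} (xs : List A) → P x → count P? (x ∷ xs) ≡ suc (count P? xs)
  count-accept xs px = cong length (filter-accept P? px)

  count-reject : {x : A} (xs : List A) → ¬ P x → count P? (x ∷ xs) ≡ count P? xs
  count-reject xs ¬px = cong length (filter-reject P? ¬px)

  count-none : {xs : List A} → All (¬_ ∘ P) xs → count P? xs ≡ 0
  count-none none = cong length (filter-none P? none)

module _ {A : Set} where

  count-mono : {P Q : Pred A 0ℓ} (P? : Decidable P) (Q? : Decidable Q) → (∀ {x} → P x → Q x) →
               (xs : List A) → count P? xs ≤ count Q? xs
  count-mono P? Q? P⇒Q xs = length-mono-≤ (filter⁺ P? Q? {xs} (λ { refl px → P⇒Q px }) ⊆-refl)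

  count-cover : {P Q R : Pred A 0ℓ} (P? : Decidable P) (Q? : Decidable Q) (R? : Decidable R) →
                (∀ {x} → P x → Q x ⊎ R x) →
                (xs : List A) → count P? xs ≤ count Q? xs + count R? xs
  count-cover P? Q? R? cover [] = z≤n
  count-cover P? Q? R? cover (x ∷ xs) with P? x
  ... | no _ = ≤-trans (count-cover P? Q? R? cover xs) (+-mono-≤ (count-≤-∷ Q? x xs) (count-≤-∷ R? x xs))
  ... | yes px with cover px
  ...   | inj₁ qx = begin
    suc (count P? xs)                         ≤⟨ s≤s (count-cover P? Q? R? cover xs) ⟩
    suc (count Q? xs + count R? xs)           ≤⟨ s≤s (+-monoʳ-≤ (count Q? xs) (count-≤-∷ R? x xs)) ⟩
    suc (count Q? xs) + count R? (x ∷ xs)     ≡⟨ cong (_+ count R? (x ∷ xs)) (sym (count-accept Q? xs qx)) ⟩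
    count Q? (x ∷ xs) + count R? (x ∷ xs)     ∎
    where open ≤-Reasoning
  ...   | inj₂ rx = begin
    suc (count P? xs)                         ≤⟨ s≤s (count-cover P? Q? R? cover xs) ⟩
    suc (count Q? xs + count R? xs)           ≤⟨ s≤s (+-mono-≤ (count-≤-∷ Q? x xs) ≤-refl) ⟩
    suc (count Q? (x ∷ xs) + count R? xs)     ≡⟨ sym (+-suc (count Q? (x ∷ xs)) (count R? xs)) ⟩
    count Q? (x ∷ xs) + suc (count R? xs)     ≡⟨ cong (count Q? (x ∷ xs) +_) (sym (count-accept R? xs rx)) ⟩
    count Q? (x ∷ xs) + count R? (x ∷ xs)     ∎
    where open ≤-Reasoning

module _ {A B : Set} {P : Pred (B × A) 0ℓ} where

  count-map-pair : (P? : Decidable P) (x : B) (ys : List A) →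
                   count P? (map (x ,_) ys) ≡ count (λ y → P? (x , y)) ys
  count-map-pair P? x [] = refl
  count-map-pair P? x (y ∷ ys) with P? (x , y)
  ... | yes _ = cong suc (count-map-pair P? x ys)
  ... | no _  = count-map-pair P? x ys

  count-product : (P? : Decidable P) (m : ℕ) (xs : List B) (ys : List A) →
                  (∀ x → count (λ y → P? (x , y)) ys ≤ m) →
                  count P? (cartesianProduct xs ys) ≤ m * length xs
  count-product P? m [] ys row = z≤n
  count-product P? m (x ∷ xs) ys row = begin
    count P? (map (x ,_) ys ++ cartesianProduct xs ys)
      ≡⟨ cong length (filter-++ P? (map (x ,_) ys) (cartesianProduct xs ys)) ⟩
    length (filter P? (map (x ,_) ys) ++ filter P? (cartesianProduct xs ys))
      ≡⟨ length-++ (filter P? (map (x ,_) ys)) ⟩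
    count P? (map (x ,_) ys) + count P? (cartesianProduct xs ys)
      ≡⟨ cong (_+ count P? (cartesianProduct xs ys)) (count-map-pair P? x ys) ⟩
    count (λ y → P? (x , y)) ys + count P? (cartesianProduct xs ys)
      ≤⟨ +-mono-≤ (row x) (count-product P? m xs ys row) ⟩
    m + m * length xs
      ≡⟨ sym (*-suc m (length xs)) ⟩
    m * suc (length xs) ∎
    where open ≤-Reasoning

module _ {s : ℕ} where

  index-is : (t : ℕ) (y : Fin s) → Dec (toℕ y ≡ t)
  index-is t y = toℕ y ≟ℕ t

  count-index-unique : {xs : List (Fin s)} → Unique xs → (t : ℕ) → count (index-is t) xs ≤ 1
  count-index-unique {[]} _ t = z≤n
  count-index-unique {x ∷ xs} (x∉xs ∷ distinct) t with index-is t x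
  ... | no x≢t  = ≤-trans (≤-reflexive (count-reject (index-is t) xs x≢t)) (count-index-unique distinct t)
  ... | yes x≡t = ≤-reflexive (trans (count-accept (index-is t) xs x≡t)
                                     (cong suc (count-none (index-is t) (All.map differ x∉xs))))
    where
    differ : ∀ {y} → x ≢ y → toℕ y ≢ t
    differ x≢y y≡t = x≢y (toℕ-injective (trans x≡t (sym y≡t)))

  count-index-∈ : {xs : List (Fin s)} → Unique xs → (ts : List ℕ) → count (λ y → toℕ y ∈? ts) xs ≤ length ts
  count-index-∈ {xs} _ [] = ≤-reflexive (count-none _ (All.universal (λ _ ()) xs))
  count-index-∈ {xs} distinct (t ∷ ts) = begin
    count (λ y → toℕ y ∈? t ∷ ts) xs
      ≤⟨ count-cover (λ y → toℕ y ∈? t ∷ ts) (index-is t) (λ y → toℕ y ∈? ts) split xs ⟩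
    count (index-is t) xs + count (λ y → toℕ y ∈? ts) xs
      ≤⟨ +-mono-≤ (count-index-unique distinct t) (count-index-∈ distinct ts) ⟩
    suc (length ts) ∎
    where
    open ≤-Reasoning
    split : ∀ {y : Fin s} → toℕ y ∈ t ∷ ts → toℕ y ≡ t ⊎ toℕ y ∈ ts
    split (here y≡t) = inj₁ y≡t
    split (there y∈ts) = inj₂ y∈ts

edgeCount-≤ : ∀ {k} (A : DFA k) (d : ℕ) (targets : Fin (states A) → List ℕ) →
              (∀ q → length (targets q) ≤ d) → (∀ q a → toℕ (δ A q a) ∈ targets q) →
              edgeCount A ≤ d * states A
edgeCount-≤ A d targets few covers = begin
  edgeCount A                  ≤⟨ count-product _ d (allFin n) (allFin n) out-degree ⟩
  d * length (allFin n)        ≡⟨ cong (d *_) (length-tabulate (λ q → q)) ⟩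
  d * n                        ∎
  where
  open ≤-Reasoning
  n : ℕ
  n = states A
  out-degree : ∀ q → count (λ q′ → any? (λ a → δ A q a ≟ q′)) (allFin n) ≤ d
  out-degree q = begin
    count (λ q′ → any? (λ a → δ A q a ≟ q′)) (allFin n)
      ≤⟨ count-mono (λ q′ → any? (λ a → δ A q a ≟ q′)) (λ y → toℕ y ∈? targets q)
                    (λ { (a , refl) → covers q a }) (allFin n) ⟩
    count (λ y → toℕ y ∈? targets q) (allFin n)
      ≤⟨ count-index-∈ (allFin⁺ n) (targets q) ⟩
    length (targets q)
      ≤⟨ few q ⟩
    d ∎

module _ {k : ℕ} where

  -- Begins w v: v has a prefix in Pref₋(w), i.e. v follows w up to a position
  -- where it carries a strictly smaller letter, or v has all of w as a prefix.
  Begins : Word k → Word k → Set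
  Begins []      v       = ⊤
  Begins (b ∷ w) []      = ⊥
  Begins (b ∷ w) (a ∷ v) = a <F b ⊎ (a ≡ b × Begins w v)

  -- Occurs w u: some suffix of u begins with a word of Pref₋(w); this is a
  -- recursive description of membership u ∈ L(w).
  Occurs : Word k → Word k → Set
  Occurs w []      = Begins w []
  Occurs w (c ∷ u) = Begins w (c ∷ u) ⊎ Occurs w u

  begins-self : (w u : Word k) → Begins w (w ++ u)
  begins-self []      u = tt
  begins-self (b ∷ w) u = inj₂ (refl , begins-self w u)

  begins-below : (w : Word k) (i : ℕ) (p : i <ℕ length w) (a : Fin k) (u : Word k) →
                 a <F letter w i p → Begins w (take i w ++ a ∷ u)
  begins-below (b ∷ w) zero    p       a u a< = inj₁ a<
  begins-below (b ∷ w) (suc i) (s≤s p) a u a< = inj₂ (refl , begins-below w i p a u a<)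

  pref-cons : (b : Fin k) (w y : Word k) → InPref₋ w y → InPref₋ (b ∷ w) (b ∷ y)
  pref-cons b w _ (inj₁ (i , p , s , s< , refl)) = inj₁ (suc i , s≤s p , s , s< , refl)
  pref-cons b w _ (inj₂ refl)                    = inj₂ refl

  begins⇒pref : (w v : Word k) → Begins w v → ∃ λ y → ∃ λ z → v ≡ y ++ z × InPref₋ w y
  begins⇒pref []      v       _                = [] , v , refl , inj₂ refl
  begins⇒pref (b ∷ w) (a ∷ v) (inj₁ a<b)       = a ∷ [] , v , refl , inj₁ (zero , s≤s z≤n , a , a<b , refl)
  begins⇒pref (b ∷ w) (a ∷ v) (inj₂ (refl , h)) with begins⇒pref w v h
  ... | y , z , refl , y∈Pref = a ∷ y , z , refl , pref-cons a w y y∈Pref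

  pref⇒begins : (w y z : Word k) → InPref₋ w y → Begins w (y ++ z)
  pref⇒begins w _ z (inj₂ refl) = begins-self w z
  pref⇒begins w _ z (inj₁ (i , p , s , s< , refl)) =
    subst (Begins w) (sym (++-assoc (take i w) (s ∷ []) z)) (begins-below w i p s z s<)

  begins⇒occurs : (w v : Word k) → Begins w v → Occurs w v
  begins⇒occurs w []      h = h
  begins⇒occurs w (c ∷ v) h = inj₁ h

  occurs-++ˡ : (w x v : Word k) → Occurs w v → Occurs w (x ++ v)
  occurs-++ˡ w []      v h = h
  occurs-++ˡ w (c ∷ x) v h = inj₂ (occurs-++ˡ w x v h)

  L⇔Occurs : (w u : Word k) → L w u ⇔ Occurs w u
  L⇔Occurs w u = mk⇔ (to u) (from u)
    where
    to : ∀ u → L w u → Occurs w u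
    to _ (x , y , z , refl , y∈Pref) =
      occurs-++ˡ w x (y ++ z) (begins⇒occurs w (y ++ z) (pref⇒begins w y z y∈Pref))
    from : ∀ u → Occurs w u → L w u
    from []      h        = [] , begins⇒pref w [] h
    from (c ∷ u) (inj₁ h) = [] , begins⇒pref w (c ∷ u) h
    from (c ∷ u) (inj₂ h) with from u h
    ... | x , y , z , refl , y∈Pref = c ∷ x , y , z , refl , y∈Pref

  occurs-suffix : (w u : Word k) → Occurs w u → ∃ λ j → j ≤ length u × Begins w (drop j u)
  occurs-suffix w []      h        = zero , z≤n , h
  occurs-suffix w (c ∷ u) (inj₁ h) = zero , z≤n , h
  occurs-suffix w (c ∷ u) (inj₂ h) with occurs-suffix w u h
  ... | j , j≤ , h′ = suc j , s≤s j≤ , h′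

  occurs-++-∷ : (w p : Word k) (a : Fin k) (v : Word k) → Occurs w (p ++ a ∷ v) →
                (∃ λ j → j ≤ length p × Begins w (drop j p ++ a ∷ v)) ⊎ Occurs w v
  occurs-++-∷ w []      a v (inj₁ h) = inj₁ (zero , z≤n , h)
  occurs-++-∷ w []      a v (inj₂ h) = inj₂ h
  occurs-++-∷ w (c ∷ p) a v (inj₁ h) = inj₁ (zero , z≤n , h)
  occurs-++-∷ w (c ∷ p) a v (inj₂ h) with occurs-++-∷ w p a v h
  ... | inj₁ (j , j≤ , h′) = inj₁ (suc j , s≤s j≤ , h′)
  ... | inj₂ h′            = inj₂ h′

  -- If w ≤lex s t with |s| < |w|, the first mismatch of s with w (if any) goes
  -- upwards, so s cannot begin with an element of Pref₋(w); the same holds for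
  -- s a v when w ≤lex s b t and a is even larger than b.
  lex-no-begin : (w s t : Word k) → w ≤lex (s ++ t) → length s <ℕ length w → ¬ Begins w s
  lex-no-begin (b ∷ w) (a ∷ s) t (this b<a)    _       (inj₁ a<b)       = <-asym b<a a<b
  lex-no-begin (b ∷ w) (a ∷ s) t (this b<a)    _       (inj₂ (refl , _)) = <-irrefl refl b<a
  lex-no-begin (b ∷ w) (a ∷ s) t (next refl _) _       (inj₁ a<a)       = <-irrefl refl a<a
  lex-no-begin (b ∷ w) (a ∷ s) t (next refl r) (s≤s l) (inj₂ (_ , h))    = lex-no-begin w s t r l h

  lex-no-begin-above : (w s : Word k) (b a : Fin k) (t v : Word k) → w ≤lex (s ++ b ∷ t) → b <F a →
                       length s <ℕ length w → ¬ Begins w (s ++ a ∷ v)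
  lex-no-begin-above (c ∷ w) [] b a t v (this c<b)    b<a _ (inj₁ a<c)        = <-asym (<-trans c<b b<a) a<c
  lex-no-begin-above (c ∷ w) [] b a t v (this c<b)    b<a _ (inj₂ (refl , _)) = <-asym c<b b<a
  lex-no-begin-above (c ∷ w) [] b a t v (next refl _) b<a _ (inj₁ a<b)        = <-asym a<b b<a
  lex-no-begin-above (c ∷ w) [] b a t v (next refl _) b<a _ (inj₂ (refl , _)) = <-irrefl refl b<a
  lex-no-begin-above (c ∷ w) (d ∷ s) b a t v (this c<d)    _ _ (inj₁ d<c)        = <-asym c<d d<c
  lex-no-begin-above (c ∷ w) (d ∷ s) b a t v (this c<d)    _ _ (inj₂ (refl , _)) = <-irrefl refl c<d
  lex-no-begin-above (c ∷ w) (d ∷ s) b a t v (next refl _) _ _ (inj₁ d<d)        = <-irrefl refl d<d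
  lex-no-begin-above (c ∷ w) (d ∷ s) b a t v (next refl r) b<a (s≤s l) (inj₂ (_ , h)) =
    lex-no-begin-above w s b a t v r b<a l h

  take-suc-letter : (w : Word k) (i : ℕ) (p : i <ℕ length w) →
                    take (suc i) w ≡ take i w ++ letter w i p ∷ []
  take-suc-letter (c ∷ w) zero    p       = refl
  take-suc-letter (c ∷ w) (suc i) (s≤s p) = cong (c ∷_) (take-suc-letter w i p)

  drop-letter : (w : Word k) (i : ℕ) (p : i <ℕ length w) → drop i w ≡ letter w i p ∷ drop (suc i) w
  drop-letter (c ∷ w) zero    p       = refl
  drop-letter (c ∷ w) (suc i) (s≤s p) = drop-letter w i p

  drop-take-split : (j i : ℕ) (w : Word k) → j ≤ i → drop j w ≡ drop j (take i w) ++ drop i w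
  drop-take-split zero    i       w       _        = sym (take++drop≡id i w)
  drop-take-split (suc j) (suc i) []      _        = refl
  drop-take-split (suc j) (suc i) (c ∷ w) (s≤s j≤i) = drop-take-split j i w j≤i

  length-take-≤ : (i : ℕ) (w : Word k) → length (take i w) ≤ i
  length-take-≤ i w = ≤-trans (≤-reflexive (length-take i w)) (m⊓n≤m i (length w))

  length-drop-take-≤ : (j i : ℕ) (w : Word k) → length (drop j (take i w)) ≤ i
  length-drop-take-≤ j i w =
    ≤-trans (≤-reflexive (length-drop j (take i w))) (≤-trans (m∸n≤m _ j) (length-take-≤ i w))

  rotate-split : (w : Word k) (j i : ℕ) (p : i <ℕ length w) → j ≤ i →
                 rotate j w ≡ drop j (take i w) ++ letter w i p ∷ drop (suc i) w ++ take j w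
  rotate-split w j i p j≤i = begin
    drop j w ++ take j w
      ≡⟨ cong (_++ take j w) (drop-take-split j i w j≤i) ⟩
    (drop j (take i w) ++ drop i w) ++ take j w
      ≡⟨ ++-assoc (drop j (take i w)) (drop i w) (take j w) ⟩
    drop j (take i w) ++ drop i w ++ take j w
      ≡⟨ cong (λ r → drop j (take i w) ++ r ++ take j w) (drop-letter w i p) ⟩
    drop j (take i w) ++ letter w i p ∷ drop (suc i) w ++ take j w ∎
    where open ≡-Reasoning

  module _ {w : Word k} (minimal : SelfMinimal w) where

    rotation-view : (j i : ℕ) (p : i <ℕ length w) → j ≤ i →
                    w ≤lex (drop j (take i w) ++ letter w i p ∷ drop (suc i) w ++ take j w)
    rotation-view j i p j≤i = subst (w ≤lex_) (rotate-split w j i p j≤i) (minimal j (<-≤-trans (s≤s j≤i) p))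

    window-short : (j i : ℕ) → i <ℕ length w → length (drop j (take i w)) <ℕ length w
    window-short j i p = <-≤-trans (s≤s (length-drop-take-≤ j i w)) p

    prefix-free : (i : ℕ) → i <ℕ length w → ¬ Occurs w (take i w)
    prefix-free i p h with occurs-suffix w (take i w) h
    ... | j , j≤ , h′ = lex-no-begin w (drop j (take i w)) _ (rotation-view j i p j≤i)
                          (window-short j i p) h′
      where
      j≤i : j ≤ i
      j≤i = ≤-trans j≤ (length-take-≤ i w)

    overshoot-forgets : (i : ℕ) (p : i <ℕ length w) (a : Fin k) (v : Word k) → letter w i p <F a →
                        Occurs w (take i w ++ a ∷ v) → Occurs w v
    overshoot-forgets i p a v w[i]<a h with occurs-++-∷ w (take i w) a v h
    ... | inj₂ h′             = h′
    ... | inj₁ (j , j≤ , h′) = ⊥-elim (lex-no-begin-above w (drop j (take i w)) (letter w i p) a _ v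
                                  (rotation-view j i p j≤i) w[i]<a (window-short j i p) h′)
      where
      j≤i : j ≤ i
      j≤i = ≤-trans j≤ (length-take-≤ i w)

does⇔ : {P : Set} (P? : Dec P) → does P? ≡ true ⇔ P
does⇔ (yes p) = mk⇔ (const p) (const refl)
does⇔ (no ¬p) = mk⇔ (λ ()) (λ p → contradiction p ¬p)

module Automaton {k : ℕ} (w : Word k) (minimal : SelfMinimal w) where

  n : ℕ
  n = length w

  step : ℕ → Fin k → ℕ
  step i a with i <? n
  ... | no _ = n
  ... | yes p with <-cmp a (letter w i p)
  ...   | tri< _ _ _ = n
  ...   | tri≈ _ _ _ = suc i
  ...   | tri> _ _ _ = zero

  step-< : (i : ℕ) (a : Fin k) → step i a <ℕ suc n
  step-< i a with i <? n
  ... | no _ = ≤-refl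
  ... | yes p with <-cmp a (letter w i p)
  ...   | tri< _ _ _ = ≤-refl
  ...   | tri≈ _ _ _ = s≤s p
  ...   | tri> _ _ _ = s≤s z≤n

  step-targets : (i : ℕ) (a : Fin k) → step i a ∈ n ∷ suc i ∷ zero ∷ []
  step-targets i a with i <? n
  ... | no _ = here refl
  ... | yes p with <-cmp a (letter w i p)
  ...   | tri< _ _ _ = here refl
  ...   | tri≈ _ _ _ = there (here refl)
  ...   | tri> _ _ _ = there (there (here refl))

  occurs-whole : (i : ℕ) (u : Word k) → n ≤ i → Occurs w (take i w ++ u)
  occurs-whole i u n≤i rewrite take-all i w n≤i = begins⇒occurs w (w ++ u) (begins-self w u)

  step-sound : (i : ℕ) (a : Fin k) (u : Word k) →
               Occurs w (take (step i a) w ++ u) ⇔ Occurs w (take i w ++ a ∷ u)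
  step-sound i a u with i <? n
  ... | no i≮n = mk⇔ (const (occurs-whole i (a ∷ u) (≮⇒≥ i≮n))) (const (occurs-whole n u ≤-refl))
  ... | yes p with <-cmp a (letter w i p)
  ...   | tri< a<w[i] _ _ = mk⇔ (const (begins⇒occurs w _ (begins-below w i p a u a<w[i])))
                                (const (occurs-whole n u ≤-refl))
  ...   | tri≈ _ refl _ = mk⇔ (subst (Occurs w) extend) (subst (Occurs w) (sym extend))
    where
    extend : take (suc i) w ++ u ≡ take i w ++ a ∷ u
    extend = trans (cong (_++ u) (take-suc-letter w i p)) (++-assoc (take i w) (a ∷ []) u)
  ...   | tri> _ _ w[i]<a = mk⇔ (occurs-++ˡ w (take i w) (a ∷ u) ∘ inj₂)
                                (overshoot-forgets minimal i p a u w[i]<a)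

  final-sound : (i : ℕ) → i ≤ n → i ≡ n ⇔ Occurs w (take i w ++ [])
  final-sound i i≤n = mk⇔ (λ { refl → occurs-whole n [] ≤-refl }) full
    where
    full : Occurs w (take i w ++ []) → i ≡ n
    full h with i ≟ℕ n
    ... | yes i≡n = i≡n
    ... | no i≢n  = contradiction (subst (Occurs w) (++-identityʳ (take i w)) h)
                                  (prefix-free minimal i (≤∧≢⇒< i≤n i≢n))

  automaton : DFA k
  automaton = record
    { states    = suc n
    ; initial   = Data.Fin.zero
    ; δ         = λ q a → fromℕ< (step-< (toℕ q) a)
    ; accepting = λ q → does (toℕ q ≟ℕ n)
    }

  run-sound : (u : Word k) (q : Fin (suc n)) →
              accepting automaton (run automaton q u) ≡ true ⇔ Occurs w (take (toℕ q) w ++ u)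
  run-sound []      q = final-sound (toℕ q) (≤-pred (toℕ<n q)) ⇔-∘ does⇔ (toℕ q ≟ℕ n)
  run-sound (a ∷ u) q =
    step-sound (toℕ q) a u ⇔-∘ subst (λ i → accepts-after ⇔ Occurs w (take i w ++ u))
                                     (toℕ-fromℕ< (step-< (toℕ q) a)) (run-sound u q′)
    where
    q′ : Fin (suc n)
    q′ = δ automaton q a
    accepts-after : Set
    accepts-after = accepting automaton (run automaton q′ u) ≡ true

  recognizes : Recognizes automaton (L w)
  recognizes u = Equivalence.from (L⇔Occurs w u) ∘ Equivalence.to (run-sound u Data.Fin.zero)
               , Equivalence.from (run-sound u Data.Fin.zero) ∘ Equivalence.to (L⇔Occurs w u)

  sparse : edgeCount automaton ≤ 3 * states automaton
  sparse = edgeCount-≤ automaton 3 (λ q → n ∷ suc (toℕ q) ∷ zero ∷ []) (const ≤-refl) targets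
    where
    targets : ∀ q a → toℕ (δ automaton q a) ∈ n ∷ suc (toℕ q) ∷ zero ∷ []
    targets q a rewrite toℕ-fromℕ< (step-< (toℕ q) a) = step-targets (toℕ q) a

states-bound : (n : ℕ) → suc n ≤ 3 * n + 3
states-bound n = ≤-trans (≤-reflexive (+-comm 1 n)) (+-mono-≤ (m≤n*m n 3) (s≤s z≤n))

corollary1 : ∃ λ (c : ℕ) →
    ∀ (k : ℕ) (w : Word k) → SelfMinimal w →
      ∃ λ (A : DFA k) →
        (states A ≤ c * length w + c)
        × (edgeCount A ≤ c * states A)
        × Recognizes A (L w)
corollary1 = 3 , λ k w minimal →
  let open Automaton w minimal in automaton , states-bound n , sparse , recognizes
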